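{- Let $n\geq 4$ and let $G=\operatorname{cor}(K_n)$ be the corona of $K_n$. Then $G$ is $\gamma_{tR}$-edge-supercritical.
   Context: All graphs are finite and simple. The corona $\operatorname{cor}(H)$ of a graph $H$ is obtained by joining each vertex of $H$ to a new vertex of degree $1$. For a graph $G$ with no isolated vertices, a total Roman dominating function (TRD-function) is a function $f:V(G)\to\{0,1,2\}$ such that every vertex $v$ with $f(v)=0$ is adjacent to some vertex $u$ with $f(u)=2$, and the subgraph induced by $\{w: f(w)>0\}$ has no isolated vertices. Its weight is $\sum_{v}f(v)$, and $\gamma_{tR}(G)$ is the minimum weight of a TRD-function on $G$. A graph $G$ with no isolated vertices is $\gamma_{tR}$-edge-supercritical if $E(\overline{G})\neq\emptyset$ and $\gamma_{tR}(G+e)\leq\gamma_{tR}(G)-2$ for every edge $e\in E(\overline{G})$. -}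

module Defs where

open import Data.Nat using (ℕ; zero; suc; _+_; _≤_)
open import Data.Fin using (Fin; zero; suc; toℕ; splitAt)
open import Data.Sum using (_⊎_; inj₁; inj₂)
open import Data.Product using (Σ; _×_; _,_; ∃-syntax)
open import Data.Empty using (⊥)
open import Relation.Nullary using (¬_)
open import Relation.Binary.PropositionalEquality using (_≡_; _≢_; refl; sym)

record Graph (m : ℕ) : Set₁ where
  field
    Adj    : Fin m → Fin m → Set
    symAdj : ∀ {u v} → Adj u v → Adj v u
    irrefl : ∀ {u} → ¬ Adj u u
open Graph public

K : (n : ℕ) → Graph n
K n = record { Adj = λ u v → u ≢ v ; symAdj = λ p q → p (sym q) ; irrefl = λ p → p refl }

-- Corona: vertices Fin m ⊎ Fin m (inj₁ = original, inj₂ = new pendant vertex),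
-- encoded in Fin (m + m) via splitAt.
CorAdj : {m : ℕ} → Graph m → Fin m ⊎ Fin m → Fin m ⊎ Fin m → Set
CorAdj H (inj₁ i) (inj₁ j) = Adj H i j
CorAdj H (inj₁ i) (inj₂ j) = i ≡ j
CorAdj H (inj₂ i) (inj₁ j) = i ≡ j
CorAdj H (inj₂ i) (inj₂ j) = ⊥

CorAdj-sym : {m : ℕ} (H : Graph m) → ∀ x y → CorAdj H x y → CorAdj H y x
CorAdj-sym H (inj₁ i) (inj₁ j) p = symAdj H p
CorAdj-sym H (inj₁ i) (inj₂ j) p = sym p
CorAdj-sym H (inj₂ i) (inj₁ j) p = sym p
CorAdj-sym H (inj₂ i) (inj₂ j) ()

CorAdj-irr : {m : ℕ} (H : Graph m) → ∀ x → ¬ CorAdj H x x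
CorAdj-irr H (inj₁ i) p = irrefl H p
CorAdj-irr H (inj₂ i) ()

cor : {m : ℕ} → Graph m → Graph (m + m)
cor {m} H = record
  { Adj    = λ u v → CorAdj H (splitAt m u) (splitAt m v)
  ; symAdj = λ {u} {v} → CorAdj-sym H (splitAt m u) (splitAt m v)
  ; irrefl = λ {u} → CorAdj-irr H (splitAt m u) }

EdgeAdj : {m : ℕ} → Graph m → Fin m → Fin m → Fin m → Fin m → Set
EdgeAdj G a b u v = Adj G u v ⊎ ((u ≡ a × v ≡ b) ⊎ (u ≡ b × v ≡ a))

addEdge : {m : ℕ} (G : Graph m) (a b : Fin m) → a ≢ b → Graph m
addEdge G a b a≢b = record
  { Adj    = EdgeAdj G a b
  ; symAdj = λ { (inj₁ p) → inj₁ (symAdj G p)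
               ; (inj₂ (inj₁ (p , q))) → inj₂ (inj₂ (q , p))
               ; (inj₂ (inj₂ (p , q))) → inj₂ (inj₁ (q , p)) }
  ; irrefl = λ { (inj₁ p) → irrefl G p
               ; (inj₂ (inj₁ (refl , refl))) → a≢b refl
               ; (inj₂ (inj₂ (refl , refl))) → a≢b refl } }

NoIsolated : {m : ℕ} → Graph m → Set
NoIsolated {m} G = ∀ (v : Fin m) → ∃[ u ] Adj G v u

sumFin : {m : ℕ} → (Fin m → ℕ) → ℕ
sumFin {zero}  f = 0
sumFin {suc m} f = f zero + sumFin (λ i → f (suc i))

weight : {m : ℕ} → (Fin m → Fin 3) → ℕ
weight f = sumFin (λ v → toℕ (f v))

record IsTRDF {m : ℕ} (G : Graph m) (f : Fin m → Fin 3) : Set where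
  field
    dom   : ∀ v → toℕ (f v) ≡ 0 → ∃[ u ] (Adj G v u × toℕ (f u) ≡ 2)
    total : ∀ v → toℕ (f v) ≢ 0 → ∃[ u ] (Adj G v u × toℕ (f u) ≢ 0)

IsγtR : {m : ℕ} → Graph m → ℕ → Set
IsγtR G k = (∃[ f ] (IsTRDF G f × weight f ≡ k))
          × (∀ f → IsTRDF G f → k ≤ weight f)

Supercritical : {m : ℕ} → Graph m → Set
Supercritical {m} G =
    NoIsolated G
  × (∃[ a ] ∃[ b ] (a ≢ b × ¬ Adj G a b))
  × (∀ (a b : Fin m) (a≢b : a ≢ b) → ¬ Adj G a b →
       ∃[ k ] ∃[ k' ] (IsγtR G k × IsγtR (addEdge G a b a≢b) k' × k' + 2 ≤ k))

-- Write cᵢ for the vertices of K n and ℓᵢ for their pendant leaves. Every TRD-function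
-- puts weight at least 2 on each pair {cᵢ, ℓᵢ}, because ℓᵢ is either 0 (so cᵢ is 2) or
-- positive with positive neighbour cᵢ; putting 2 on every cᵢ attains this, so the value
-- is 2n. A non-edge is cᵢℓⱼ or ℓᵢℓⱼ (i ≠ j). After adding cᵢℓⱼ, ℓⱼ is dominated by cᵢ,
-- so cⱼ can drop to 0; after adding ℓᵢℓⱼ, labelling ℓᵢ, ℓⱼ by 1 and the other cores by 2
-- works (here n ≥ 4 keeps every core next to a core of weight 2). In both cases the pair
-- argument still applies to the n − 1 untouched pairs (resp. to {cᵢ, ℓᵢ, cⱼ, ℓⱼ} jointly),
-- so the value drops to 2(n − 1).
module Submission where

open import Defs
open import Data.Nat using (ℕ; zero; suc; _+_; _*_; _≤_; _<_; z≤n)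
open import Data.Nat.Properties
  using (+-0-commutativeMonoid; +-assoc; +-comm; +-identityʳ; +-mono-≤; ≤-refl; ≤-trans;
         ≤-reflexive; m≤n+m; m≤m+n; <⇒≤; <⇒≱; n≢0⇒n>0)
  renaming (_≟_ to _≟ℕ_)
open import Data.Fin using (Fin; zero; suc; toℕ; splitAt; join; _↑ˡ_; _↑ʳ_; punchIn; punchOut; _≟_)
open import Data.Fin.Patterns using (0F; 1F; 2F)
open import Data.Fin.Properties
  using (splitAt-↑ˡ; splitAt-↑ʳ; join-splitAt; +↔⊎; punchInᵢ≢i; punchIn-injective;
         punchIn-punchOut; any?; ¬∀⟶∃¬; injective⇒≤)
open import Data.Vec.Functional using (removeAt; []; _∷_)
open import Algebra.Properties.CommutativeMonoid.Sum +-0-commutativeMonoid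
  using (sum; sum-remove; ∑-distrib-+; sum-cong-≗)
open import Data.Bool using (Bool; true; false; _∨_)
open import Data.Bool.Properties using (∨-zeroʳ)
open import Data.Sum using (_⊎_; inj₁; inj₂; [_,_]′)
open import Data.Sum.Properties using (inj₂-injective)
open import Data.Product using (_×_; _,_; proj₁; proj₂; ∃-syntax; map₂)
open import Function using (_∘_; _↔_; Inverse)
open import Level using (0ℓ)
open import Relation.Binary using (Rel; Reflexive; _Preserves₂_⟶_⟶_)
open import Relation.Nullary using (¬_; yes; no; does; contradiction)
open import Relation.Nullary.Decidable using (dec-true; dec-false)
open import Relation.Binary.PropositionalEquality

sumFin≡sum : ∀ {m} (g : Fin m → ℕ) → sumFin g ≡ sum g
sumFin≡sum {zero}  g = refl
sumFin≡sum {suc m} g = cong (g zero +_) (sumFin≡sum (g ∘ suc))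

sum-↑ : ∀ m {n} (g : Fin (m + n) → ℕ) → sum g ≡ sum (g ∘ (_↑ˡ n)) + sum (g ∘ (m ↑ʳ_))
sum-↑ zero    g = refl
sum-↑ (suc m) g = trans (cong (g zero +_) (sum-↑ m (g ∘ suc))) (sym (+-assoc (g zero) _ _))

sum-remove₂ : ∀ {m} (g : Fin (suc (suc m)) → ℕ) {i j} (j≢i : j ≢ i) →
              sum g ≡ (g i + g j) + sum (removeAt (removeAt g j) (punchOut j≢i))
sum-remove₂ g {i} {j} j≢i = begin
  sum g                              ≡⟨ sum-remove {i = j} g ⟩
  g j + sum g′                       ≡⟨ cong (g j +_) (sum-remove {i = i′} g′) ⟩
  g j + (g (punchIn j i′) + rest)    ≡⟨ cong (λ x → g j + (g x + rest)) (punchIn-punchOut j≢i) ⟩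
  g j + (g i + rest)                 ≡⟨ sym (+-assoc (g j) (g i) rest) ⟩
  (g j + g i) + rest                 ≡⟨ cong (_+ rest) (+-comm (g j) (g i)) ⟩
  (g i + g j) + rest                 ∎
  where
  open ≡-Reasoning
  g′ = removeAt g j
  i′ = punchOut j≢i
  rest = sum (removeAt g′ i′)

-- Stated for any relation compatible with addition, so that one proof gives both the
-- exact weight of a labelling (for _≡_) and the lower bound for all labellings (for _≤_).
module SumBound {_∼_ : Rel ℕ 0ℓ} (∼-refl : Reflexive _∼_)
                (∼-+ : _+_ Preserves₂ _∼_ ⟶ _∼_ ⟶ _∼_) where

  sum-const : ∀ {m c : ℕ} (g : Fin m → ℕ) → (∀ k → c ∼ g k) → (m * c) ∼ sum g
  sum-const {zero}  g _   = ∼-refl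
  sum-const {suc m} g c∼g = ∼-+ (c∼g zero) (sum-const (g ∘ suc) (c∼g ∘ suc))

  sum-except₁ : ∀ {m c : ℕ} (g : Fin (suc m) → ℕ) {j} → 0 ∼ g j → (∀ k → k ≢ j → c ∼ g k) →
                (m * c) ∼ sum g
  sum-except₁ {m} {c} g {j} 0∼gj c∼g = subst ((m * c) ∼_) (sym (sum-remove {i = j} g))
    (∼-+ 0∼gj (sum-const (removeAt g j) λ k → c∼g (punchIn j k) (punchInᵢ≢i j k)))

  sum-except₂ : ∀ {m c : ℕ} (g : Fin (suc m) → ℕ) {i j} → i ≢ j → c ∼ (g i + g j) →
                (∀ k → k ≢ i → k ≢ j → c ∼ g k) → (m * c) ∼ sum g
  sum-except₂ {zero}  g {zero} {zero} i≢j = contradiction refl i≢j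
  sum-except₂ {suc m} {c} g {i} {j} i≢j c∼gij c∼g = subst ((suc m * c) ∼_) (sym (sum-remove₂ g j≢i))
    (∼-+ c∼gij (sum-const _ λ k → c∼g _ (≢i k) (punchInᵢ≢i j _)))
    where
    j≢i = i≢j ∘ sym
    i′ = punchOut j≢i
    ≢i : ∀ k → punchIn j (punchIn i′ k) ≢ i
    ≢i k e = punchInᵢ≢i i′ k (punchIn-injective j _ _ (trans e (sym (punchIn-punchOut j≢i))))

module Sum≡ = SumBound {_∼_ = _≡_} refl (cong₂ _+_)
module Sum≤ = SumBound {_∼_ = _≤_} ≤-refl +-mono-≤

fresh : ∀ {k n} → k < n → (p : Fin k → Fin n) → ∃[ l ] (∀ x → l ≢ p x)
fresh {k} {n} k<n p =
  map₂ (λ unhit x l≡px → unhit (x , sym l≡px)) (¬∀⟶∃¬ n _ (λ l → any? (λ x → p x ≟ l)) ¬surjective)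
  where
  ¬surjective : ¬ (∀ l → ∃[ x ] p x ≡ l)
  ¬surjective surj = <⇒≱ k<n (injective⇒≤ {f = proj₁ ∘ surj}
    λ {l} {l′} e → trans (sym (proj₂ (surj l))) (trans (cong p e) (proj₂ (surj l′))))

≡2⇒≢0 : ∀ {x} → x ≡ 2 → x ≢ 0
≡2⇒≢0 refl ()

_⊆_ : ∀ {m} → Graph m → Graph m → Set
G ⊆ H = ∀ {u v} → Adj G u v → Adj H u v

record Pendant {m} (G : Graph m) (v u : Fin m) : Set where
  constructor pendant
  field
    sole-neighbour : ∀ {w} → Adj G v w → w ≡ u
open Pendant

⊆-addEdge : ∀ {m} (G : Graph m) {a b} (a≢b : a ≢ b) → G ⊆ addEdge G a b a≢b
⊆-addEdge G a≢b = inj₁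

addEdge-neighbour : ∀ {m} (G : Graph m) {a b} (a≢b : a ≢ b) {w} →
                    Adj (addEdge G a b a≢b) a w → Adj G a w ⊎ w ≡ b
addEdge-neighbour G a≢b (inj₁ aw)               = inj₁ aw
addEdge-neighbour G a≢b (inj₂ (inj₁ (_ , w≡b))) = inj₂ w≡b
addEdge-neighbour G a≢b (inj₂ (inj₂ (a≡b , _))) = contradiction a≡b a≢b

addEdge-Pendant : ∀ {m} (G : Graph m) {a b v u} (a≢b : a ≢ b) → v ≢ a → v ≢ b →
                  Pendant G v u → Pendant (addEdge G a b a≢b) v u
addEdge-Pendant G a≢b v≢a v≢b pend = pendant λ
  { (inj₁ vw)               → sole-neighbour pend vw
  ; (inj₂ (inj₁ (v≡a , _))) → contradiction v≡a v≢a
  ; (inj₂ (inj₂ (v≡b , _))) → contradiction v≡b v≢b }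

IsTRDF-transport : ∀ {m} {A : Set} (G : Graph m) (e : Fin m ↔ A) (h : A → Fin 3) →
  let open Inverse e in
  (∀ x → toℕ (h x) ≡ 0 → ∃[ y ] (Adj G (from x) (from y) × toℕ (h y) ≡ 2)) →
  (∀ x → toℕ (h x) ≢ 0 → ∃[ y ] (Adj G (from x) (from y) × toℕ (h y) ≢ 0)) →
  IsTRDF G (h ∘ to)
IsTRDF-transport G e h dom total = record
  { dom   = λ v hv≡0 → move {λ x → x ≡ 2} v (dom (to v) hv≡0)
  ; total = λ v hv≢0 → move {λ x → x ≢ 0} v (total (to v) hv≢0) }
  where
  open Inverse e
  move : ∀ {P : ℕ → Set} v → ∃[ y ] (Adj G (from (to v)) (from y) × P (toℕ (h y))) →
         ∃[ u ] (Adj G v u × P (toℕ (h (to u))))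
  move {P} v (y , adj , p) =
    from y , subst (λ u → Adj G u (from y)) (strictlyInverseʳ v) adj ,
    subst (λ x → P (toℕ (h x))) (sym (strictlyInverseˡ y)) p

IsTRDF⇒neighbour : ∀ {m} {G : Graph m} {f} → IsTRDF G f →
                   ∀ v → ∃[ u ] (Adj G v u × 2 ≤ toℕ (f v) + toℕ (f u))
IsTRDF⇒neighbour {f = f} T v with toℕ (f v) ≟ℕ 0
... | yes fv≡0 = let u , vu , fu≡2 = IsTRDF.dom T v fv≡0 in
                 u , vu , ≤-reflexive (sym (cong₂ _+_ fv≡0 fu≡2))
... | no fv≢0  = let u , vu , fu≢0 = IsTRDF.total T v fv≢0 in
                 u , vu , +-mono-≤ (n≢0⇒n>0 fv≢0) (n≢0⇒n>0 fu≢0)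

Pendant⇒2≤ : ∀ {m} {G : Graph m} {f v u} → IsTRDF G f → Pendant G v u →
             2 ≤ toℕ (f u) + toℕ (f v)
Pendant⇒2≤ {f = f} {v} {u} T pend with IsTRDF⇒neighbour T v
... | w , vw , 2≤ rewrite sole-neighbour pend vw =
  ≤-trans 2≤ (≤-reflexive (+-comm (toℕ (f v)) (toℕ (f u))))

module CoronaOfComplete (m : ℕ) where

  n N : ℕ
  n = suc m
  N = n + n

  G : Graph N
  G = cor (K n)

  C L : Fin n → Fin N
  C k = k ↑ˡ n
  L k = n ↑ʳ k

  C-adj-C : ∀ {k l} → k ≢ l → Adj G (C k) (C l)
  C-adj-C {k} {l} = subst₂ (CorAdj (K n)) (sym (splitAt-↑ˡ n k n)) (sym (splitAt-↑ˡ n l n))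

  L-adj-C : ∀ k → Adj G (L k) (C k)
  L-adj-C k = subst₂ (CorAdj (K n)) (sym (splitAt-↑ʳ n n k)) (sym (splitAt-↑ˡ n k n)) refl

  C-adj-L : ∀ k → Adj G (C k) (L k)
  C-adj-L k = symAdj G {L k} {C k} (L-adj-C k)

  L-pendant : ∀ {k} → Pendant G (L k) (C k)
  L-pendant {k} = pendant λ {w} adj → trans (sym (join-splitAt n n w))
    (toC (splitAt n w) (subst (λ x → CorAdj (K n) x (splitAt n w)) (splitAt-↑ʳ n n k) adj))
    where
    toC : ∀ x → CorAdj (K n) (inj₂ k) x → join n n x ≡ C k
    toC (inj₁ l) k≡l = cong C (sym k≡l)

  L-injective : ∀ {k l} → L k ≡ L l → k ≡ l
  L-injective {k} {l} e =
    inj₂-injective (trans (sym (splitAt-↑ʳ n n k)) (trans (cong (splitAt n) e) (splitAt-↑ʳ n n l)))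

  L-≢ : ∀ {k l} → k ≢ l → L k ≢ L l
  L-≢ k≢l = k≢l ∘ L-injective

  L≢C : ∀ {k l} → L k ≢ C l
  L≢C {k} {l} e with trans (sym (splitAt-↑ʳ n n k)) (trans (cong (splitAt n) e) (splitAt-↑ˡ n l n))
  ... | ()

  data Vertex : Fin N → Set where
    core : ∀ k → Vertex (C k)
    leaf : ∀ k → Vertex (L k)

  vertex : ∀ v → Vertex v
  vertex v = subst Vertex (join-splitAt n n v) (classify (splitAt n v))
    where
    classify : ∀ x → Vertex (join n n x)
    classify (inj₁ k) = core k
    classify (inj₂ k) = leaf k

  pairWeight : (Fin N → Fin 3) → Fin n → ℕ
  pairWeight f k = toℕ (f (C k)) + toℕ (f (L k))

  weight≡∑pairWeight : ∀ f → weight f ≡ sum (pairWeight f)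
  weight≡∑pairWeight f = begin
    weight f                                ≡⟨ sumFin≡sum (toℕ ∘ f) ⟩
    sum (toℕ ∘ f)                           ≡⟨ sum-↑ n (toℕ ∘ f) ⟩
    sum (toℕ ∘ f ∘ C) + sum (toℕ ∘ f ∘ L)   ≡⟨ sym (∑-distrib-+ (toℕ ∘ f ∘ C) (toℕ ∘ f ∘ L)) ⟩
    sum (pairWeight f)                      ∎
    where open ≡-Reasoning

  V : Set
  V = Fin n ⊎ Fin n

  labelWeight : (V → Fin 3) → Fin n → ℕ
  labelWeight h k = toℕ (h (inj₁ k)) + toℕ (h (inj₂ k))

  weight-labelling : ∀ h → weight (h ∘ splitAt n) ≡ sum (labelWeight h)
  weight-labelling h = trans (weight≡∑pairWeight (h ∘ splitAt n)) (sum-cong-≗ λ k →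
    cong₂ _+_ (cong (toℕ ∘ h) (splitAt-↑ˡ n k n)) (cong (toℕ ∘ h) (splitAt-↑ʳ n n k)))

  2≤pairWeight₂ : ∀ {G′ f i j} → IsTRDF G′ f → (∀ {w} → Adj G′ (L i) w → w ≡ C i ⊎ w ≡ L j) →
                  2 ≤ pairWeight f i + pairWeight f j
  2≤pairWeight₂ {f = f} {i} {j} T nbhd with IsTRDF⇒neighbour T (L i)
  ... | w , adj , 2≤ with nbhd adj
  ...   | inj₁ refl = ≤-trans 2≤ (≤-trans (≤-reflexive (+-comm (toℕ (f (L i))) _))
                                          (m≤m+n (pairWeight f i) _))
  ...   | inj₂ refl = ≤-trans 2≤ (+-mono-≤ (m≤n+m _ (toℕ (f (C i)))) (m≤n+m _ (toℕ (f (C j)))))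

  coreLabel : Bool → Fin 3
  coreLabel true  = 0F
  coreLabel false = 2F

  leafLabel : Bool → Fin 3
  leafLabel true  = 1F
  leafLabel false = 0F

  γtR-corona : 1 < n → IsγtR G (n * 2)
  γtR-corona 1<n = (h ∘ splitAt n , IsTRDF-transport G +↔⊎ h dom total , weightEq) , lower
    where
    h : V → Fin 3
    h = [ (λ _ → 2F) , (λ _ → 0F) ]′
    dom : ∀ x → toℕ (h x) ≡ 0 → ∃[ y ] (Adj G (join n n x) (join n n y) × toℕ (h y) ≡ 2)
    dom (inj₂ k) _ = inj₁ k , L-adj-C k , refl
    total : ∀ x → toℕ (h x) ≢ 0 → ∃[ y ] (Adj G (join n n x) (join n n y) × toℕ (h y) ≢ 0)
    total (inj₁ k) _ = let l , l≢ = fresh 1<n (k ∷ []) in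
                       inj₁ l , C-adj-C (l≢ 0F ∘ sym) , λ ()
    total (inj₂ k) 0≢0 = contradiction refl 0≢0
    weightEq : weight (h ∘ splitAt n) ≡ n * 2
    weightEq = trans (weight-labelling h) (sym (Sum≡.sum-const (labelWeight h) λ _ → refl))
    lower : ∀ f → IsTRDF G f → n * 2 ≤ weight f
    lower f T = subst (n * 2 ≤_) (sym (weight≡∑pairWeight f))
      (Sum≤.sum-const (pairWeight f) λ k → Pendant⇒2≤ T (L-pendant {k}))

  γtR-corona+core-leaf : ∀ {i j} → 2 < n → (G′ : Graph N) → G ⊆ G′ → i ≢ j → Adj G′ (C i) (L j) →
                         (∀ {k} → k ≢ j → Pendant G′ (L k) (C k)) → IsγtR G′ (m * 2)
  γtR-corona+core-leaf {i} {j} 2<n G′ G⊆G′ i≢j ij pend =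
    (h ∘ splitAt n , IsTRDF-transport G′ +↔⊎ h dom total , weightEq) , lower
    where
    h : V → Fin 3
    h = [ (λ k → coreLabel (does (k ≟ j))) , (λ _ → 0F) ]′
    core≡2 : ∀ {k} → k ≢ j → toℕ (h (inj₁ k)) ≡ 2
    core≡2 {k} k≢j = cong (toℕ ∘ coreLabel) (dec-false (k ≟ j) k≢j)
    coreNeighbour : ∀ k → ∃[ y ] (Adj G′ (C k) (join n n y) × toℕ (h y) ≡ 2)
    coreNeighbour k = let l , l≢ = fresh 2<n (j ∷ k ∷ []) in
                      inj₁ l , G⊆G′ (C-adj-C (l≢ 1F ∘ sym)) , core≡2 (l≢ 0F)
    dom : ∀ x → toℕ (h x) ≡ 0 → ∃[ y ] (Adj G′ (join n n x) (join n n y) × toℕ (h y) ≡ 2)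
    dom (inj₁ k) _ = coreNeighbour k
    dom (inj₂ k) _ with k ≟ j
    ... | yes refl = inj₁ i , symAdj G′ ij , core≡2 i≢j
    ... | no k≢j   = inj₁ k , G⊆G′ (L-adj-C k) , core≡2 k≢j
    total : ∀ x → toℕ (h x) ≢ 0 → ∃[ y ] (Adj G′ (join n n x) (join n n y) × toℕ (h y) ≢ 0)
    total (inj₁ k) _   = map₂ (map₂ ≡2⇒≢0) (coreNeighbour k)
    total (inj₂ k) 0≢0 = contradiction refl 0≢0
    weightEq : weight (h ∘ splitAt n) ≡ m * 2
    weightEq = trans (weight-labelling h) (sym (Sum≡.sum-except₁ (labelWeight h)
      (sym (trans (+-identityʳ _) (cong (toℕ ∘ coreLabel) (dec-true (j ≟ j) refl))))
      λ k k≢j → sym (trans (+-identityʳ _) (core≡2 k≢j))))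
    lower : ∀ f → IsTRDF G′ f → m * 2 ≤ weight f
    lower f T = subst (m * 2 ≤_) (sym (weight≡∑pairWeight f))
      (Sum≤.sum-except₁ (pairWeight f) z≤n λ k k≢j → Pendant⇒2≤ T (pend k≢j))

  γtR-corona+leaf-leaf : ∀ {i j} → 3 < n → (G′ : Graph N) → G ⊆ G′ → i ≢ j → Adj G′ (L i) (L j) →
                         (∀ {w} → Adj G′ (L i) w → w ≡ C i ⊎ w ≡ L j) →
                         (∀ {k} → k ≢ i → k ≢ j → Pendant G′ (L k) (C k)) → IsγtR G′ (m * 2)
  γtR-corona+leaf-leaf {i} {j} 3<n G′ G⊆G′ i≢j ij nbhd pend =
    (h ∘ splitAt n , IsTRDF-transport G′ +↔⊎ h dom total , weightEq) , lower
    where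
    end : Fin n → Bool
    end k = does (k ≟ i) ∨ does (k ≟ j)
    end-i : end i ≡ true
    end-i = cong (_∨ does (i ≟ j)) (dec-true (i ≟ i) refl)
    end-j : end j ≡ true
    end-j = trans (cong (does (j ≟ i) ∨_) (dec-true (j ≟ j) refl)) (∨-zeroʳ _)
    end-≢ : ∀ {k} → k ≢ i → k ≢ j → end k ≡ false
    end-≢ {k} k≢i k≢j = cong₂ _∨_ (dec-false (k ≟ i) k≢i) (dec-false (k ≟ j) k≢j)
    h : V → Fin 3
    h = [ coreLabel ∘ end , leafLabel ∘ end ]′
    core≡2 : ∀ k → end k ≡ false → toℕ (h (inj₁ k)) ≡ 2
    core≡2 _ e = cong (toℕ ∘ coreLabel) e
    leaf≢0 : ∀ k → end k ≡ true → toℕ (h (inj₂ k)) ≢ 0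
    leaf≢0 _ e = subst (λ b → toℕ (leafLabel b) ≢ 0) (sym e) λ ()
    labelWeight≡ : ∀ k b → end k ≡ b → labelWeight h k ≡ toℕ (coreLabel b) + toℕ (leafLabel b)
    labelWeight≡ _ _ e = cong (λ b → toℕ (coreLabel b) + toℕ (leafLabel b)) e
    coreNeighbour : ∀ k → ∃[ y ] (Adj G′ (C k) (join n n y) × toℕ (h y) ≡ 2)
    coreNeighbour k = let l , l≢ = fresh 3<n (i ∷ j ∷ k ∷ []) in
                      inj₁ l , G⊆G′ (C-adj-C (l≢ 2F ∘ sym)) , core≡2 l (end-≢ (l≢ 0F) (l≢ 1F))
    dom : ∀ x → toℕ (h x) ≡ 0 → ∃[ y ] (Adj G′ (join n n x) (join n n y) × toℕ (h y) ≡ 2)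
    dom (inj₁ k) _ = coreNeighbour k
    dom (inj₂ k) hk≡0 with k ≟ i | k ≟ j
    ... | no k≢i | no k≢j = inj₁ k , G⊆G′ (L-adj-C k) , core≡2 k (end-≢ k≢i k≢j)
    ... | no _   | yes _  = contradiction hk≡0 λ ()
    ... | yes _  | _      = contradiction hk≡0 λ ()
    total : ∀ x → toℕ (h x) ≢ 0 → ∃[ y ] (Adj G′ (join n n x) (join n n y) × toℕ (h y) ≢ 0)
    total (inj₁ k) _ = map₂ (map₂ ≡2⇒≢0) (coreNeighbour k)
    total (inj₂ k) hk≢0 with k ≟ i | k ≟ j
    ... | yes refl | _        = inj₂ j , ij , leaf≢0 j end-j
    ... | no _     | yes refl = inj₂ i , symAdj G′ ij , leaf≢0 i end-i
    ... | no _     | no _     = contradiction refl hk≢0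
    weightEq : weight (h ∘ splitAt n) ≡ m * 2
    weightEq = trans (weight-labelling h) (sym (Sum≡.sum-except₂ (labelWeight h) i≢j
      (sym (cong₂ _+_ (labelWeight≡ i true end-i) (labelWeight≡ j true end-j)))
      λ k k≢i k≢j → sym (labelWeight≡ k false (end-≢ k≢i k≢j))))
    lower : ∀ f → IsTRDF G′ f → m * 2 ≤ weight f
    lower f T = subst (m * 2 ≤_) (sym (weight≡∑pairWeight f))
      (Sum≤.sum-except₂ (pairWeight f) i≢j (2≤pairWeight₂ T nbhd)
        λ k k≢i k≢j → Pendant⇒2≤ T (pend k≢i k≢j))

  γtR-corona+edge : 3 < n → ∀ a b (a≢b : a ≢ b) → ¬ Adj G a b → IsγtR (addEdge G a b a≢b) (m * 2)
  γtR-corona+edge 3<n a b a≢b ¬ab with vertex a | vertex b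
  ... | core i | core j = contradiction (C-adj-C (a≢b ∘ cong C)) ¬ab
  ... | core i | leaf j =
    γtR-corona+core-leaf (<⇒≤ 3<n) _ (⊆-addEdge G a≢b) i≢j (inj₂ (inj₁ (refl , refl)))
      λ k≢j → addEdge-Pendant G a≢b L≢C (L-≢ k≢j) L-pendant
    where
    i≢j : i ≢ j
    i≢j refl = ¬ab (C-adj-L i)
  ... | leaf j | core i =
    γtR-corona+core-leaf (<⇒≤ 3<n) _ (⊆-addEdge G a≢b) i≢j (inj₂ (inj₂ (refl , refl)))
      λ k≢j → addEdge-Pendant G a≢b (L-≢ k≢j) L≢C L-pendant
    where
    i≢j : i ≢ j
    i≢j refl = ¬ab (L-adj-C i)
  ... | leaf i | leaf j =
    γtR-corona+leaf-leaf 3<n _ (⊆-addEdge G a≢b) (a≢b ∘ cong L) (inj₂ (inj₁ (refl , refl)))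
      neighbourOfLi λ k≢i k≢j → addEdge-Pendant G a≢b (L-≢ k≢i) (L-≢ k≢j) L-pendant
    where
    neighbourOfLi : ∀ {w} → Adj (addEdge G (L i) (L j) a≢b) (L i) w → w ≡ C i ⊎ w ≡ L j
    neighbourOfLi adj with addEdge-neighbour G a≢b adj
    ... | inj₁ Li-w = inj₁ (sole-neighbour (L-pendant {i}) Li-w)
    ... | inj₂ w≡Lj = inj₂ w≡Lj

  noIsolated : NoIsolated G
  noIsolated v with vertex v
  ... | core k = L k , C-adj-L k
  ... | leaf k = C k , L-adj-C k

  nonEdge : 1 < n → ∃[ a ] ∃[ b ] (a ≢ b × ¬ Adj G a b)
  nonEdge 1<n = let l , l≢0 = fresh 1<n (0F ∷ []) in
    L 0F , L l , L-≢ (l≢0 0F ∘ sym) , λ adj → L≢C (sole-neighbour L-pendant adj)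

proposition4p4 : (n : ℕ) → 4 ≤ n → Supercritical (cor (K n))
proposition4p4 zero    ()
proposition4p4 (suc m) 3<n =
  noIsolated , nonEdge 1<n ,
  λ a b a≢b ¬ab → suc m * 2 , m * 2 , γtR-corona 1<n , γtR-corona+edge 3<n a b a≢b ¬ab ,
                  ≤-reflexive (+-comm (m * 2) 2)
  where
  open CoronaOfComplete m
  1<n = <⇒≤ (<⇒≤ 3<n)
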